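{- For any ultrafilters $U,V$ on countable sets, $U\cdot V\cdot V\equiv_T U\times(V\cdot V)$. In particular, $(U\cdot U)\cdot(V\cdot V)\equiv_T(V\cdot V)\cdot(U\cdot U)$.
   Context: For filters $U$ on $X$, $V$ on $Y$, $U\cdot V$ is the filter on $X\times Y$ with $A\in U\cdot V$ iff $\{x:\{y:(x,y)\in A\}\in V\}\in U$. Ultrafilters are ordered by $\supseteq$; $U\times W$ denotes the product poset with the coordinatewise order. $P\le_TQ$ means there is $f:Q\to P$ mapping cofinal subsets of $Q$ to cofinal subsets of $P$; $\equiv_T$ is two-way $\le_T$. -}

module Defs where

open import Level using (Level; _⊔_; Lift) renaming (suc to lsuc; zero to lzero)
open import Data.Nat using (ℕ)
open import Data.Product using (Σ; ∃; _×_; _,_; proj₁; proj₂)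
open import Data.Sum using (_⊎_)
open import Data.Empty using (⊥)
open import Data.Unit using (⊤)
open import Relation.Nullary using (¬_)
open import Relation.Binary.PropositionalEquality using (_≡_)
open import Function.Definitions using (Injective)

Subset : Set → Set₁
Subset X = X → Set

_⊆_ : {X : Set} → Subset X → Subset X → Set
A ⊆ B = ∀ x → A x → B x

_∩_ : {X : Set} → Subset X → Subset X → Subset X
(A ∩ B) x = A x × B x

∁ : {X : Set} → Subset X → Subset X
∁ A x = ¬ A x

Whole : {X : Set} → Subset X
Whole _ = ⊤

Empty : {X : Set} → Subset X
Empty _ = ⊥

Family : Set → Set₁
Family X = Subset X → Set

Countable : Set → Set
Countable X = Σ (X → ℕ) (λ f → Injective _≡_ _≡_ f)

record Ultrafilter (X : Set) : Set₁ where
  field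
    mem      : Family X
    whole    : mem Whole
    proper   : ¬ mem Empty
    upward   : ∀ {A B} → mem A → A ⊆ B → mem B
    meet     : ∀ {A B} → mem A → mem B → mem (A ∩ B)
    ultra    : ∀ A → mem A ⊎ mem (∁ A)
open Ultrafilter public

_·_ : {X Y : Set} → Family X → Family Y → Family (X × Y)
(U · V) A = U (λ x → V (λ y → A (x , y)))
infixl 7 _·_

record Ord (ℓ : Level) : Set (lsuc ℓ) where
  constructor ord
  field
    Carrier : Set ℓ
    _≤_     : Carrier → Carrier → Set ℓ
open Ord public

⊇-Ord : {X : Set} → Family X → Ord (lsuc lzero)
⊇-Ord {X} 𝒰 = ord (Σ (Subset X) 𝒰) (λ A B → Lift (lsuc lzero) (proj₁ B ⊆ proj₁ A))

_×ᴼ_ : ∀ {ℓ} → Ord ℓ → Ord ℓ → Ord ℓ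
P ×ᴼ Q = ord (Carrier P × Carrier Q)
             (λ a b → _≤_ P (proj₁ a) (proj₁ b) × _≤_ Q (proj₂ a) (proj₂ b))

Cofinal : ∀ {ℓ} (P : Ord ℓ) → (Carrier P → Set ℓ) → Set ℓ
Cofinal P C = ∀ p → ∃ λ c → C c × _≤_ P p c

Image : ∀ {ℓ} {A B : Set ℓ} → (A → B) → (A → Set ℓ) → B → Set ℓ
Image f C b = ∃ λ a → C a × f a ≡ b

_≤T_ : ∀ {ℓ} → Ord ℓ → Ord ℓ → Set (lsuc ℓ)
P ≤T Q = Σ (Carrier Q → Carrier P) λ f →
           ∀ (C : Carrier Q → Set _) → Cofinal Q C → Cofinal P (Image f C)

_≡T_ : ∀ {ℓ} → Ord ℓ → Ord ℓ → Set (lsuc ℓ)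
P ≡T Q = (P ≤T Q) × (Q ≤T P)

{-# OPTIONS --safe #-}
-- Projecting A ⊆ X × Y × Y to X (the x with V·V-large fibre) and to Y × Y gives
-- U × V·V ≤T U·V·V for any ultrafilters.  Conversely, if V is principal then U·V·V is a copy
-- of U; otherwise fix injections r : X → ℕ, e : Y → ℕ and send (A , B) to the set of
-- (x , y , z) with x ∈ A, (y , z) ∈ B and (y′ , y) ∈ B for some y′ with r x ≤ e y′ ≤ e y.
-- Every D ∈ U·V·V contains such a set: as r x ≤ e y, the condition on (y , z) needed to stay
-- inside D involves only finitely many x, so the matching B is a finite intersection of
-- V-large sets.  These finite intersections also exist for the rank r x₁ + r x₂ on X × X,
-- which gives the result for U·U in place of U; the second claim then follows by commuting
-- the factors of U·U × V·V.
module Submission where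

open import Defs
open import Axiom.ExcludedMiddle using (ExcludedMiddle)
open import Level using (Level; lift) renaming (zero to lzero)
open import Data.Nat using (ℕ; zero; suc; _+_; _<_; s≤s) renaming (_≤_ to _≤ₙ_)
open import Data.Nat.Properties using (m<1+n⇒m<n∨m≡n; ≮⇒≥; ≤-trans; ≤-<-trans; m≤m+n; m≤n+m)
open import Data.Product using (∃; _×_; _,_; proj₁; proj₂)
open import Data.Sum using (_⊎_; inj₁; inj₂; [_,_])
open import Data.Empty using (⊥-elim)
open import Data.Unit using (⊤; tt)
open import Function using (_∘_)
open import Function.Definitions using (Injective)
open import Relation.Nullary using (¬_; yes; no)
open import Relation.Binary.PropositionalEquality using (_≡_; refl; sym; trans; subst)

module _ {ℓ : Level} where

  Convergent : (P Q : Ord ℓ) → (Carrier Q → Carrier P) → Set ℓ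
  Convergent P Q f = ∀ p → ∃ λ q → ∀ {q′} → _≤_ Q q q′ → _≤_ P p (f q′)

  convergent⇒≤T : (P Q : Ord ℓ) (f : Carrier Q → Carrier P) → Convergent P Q f → P ≤T Q
  convergent⇒≤T P Q f f-convergent = f , image-cofinal
    where
    image-cofinal : ∀ C → Cofinal Q C → Cofinal P (Image f C)
    image-cofinal C C-cofinal p with f-convergent p
    ... | q , above-q with C-cofinal q
    ...   | c , Cc , q≤c = f c , (c , Cc , refl) , above-q q≤c

  ≤T-trans : {P Q R : Ord ℓ} → P ≤T Q → Q ≤T R → P ≤T R
  ≤T-trans {P} (f , f-cof) (g , g-cof) =
    f ∘ g , λ C C-cofinal p → regroup (f-cof _ (g-cof C C-cofinal) p)
    where
    regroup : ∀ {C p} → (∃ λ c → Image f (Image g C) c × _≤_ P p c) →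
              ∃ λ c → Image (f ∘ g) C c × _≤_ P p c
    regroup (c , (_ , (a , Ca , refl) , refl) , p≤c) = c , (a , Ca , refl) , p≤c

  ≡T-trans : {P Q R : Ord ℓ} → P ≡T Q → Q ≡T R → P ≡T R
  ≡T-trans (P≤Q , Q≤P) (Q≤R , R≤Q) = ≤T-trans P≤Q Q≤R , ≤T-trans R≤Q Q≤P

  ≡T-sym : {P Q : Ord ℓ} → P ≡T Q → Q ≡T P
  ≡T-sym (P≤Q , Q≤P) = Q≤P , P≤Q

  ×ᴼ-comm-≤T : {P Q : Ord ℓ} → (P ×ᴼ Q) ≤T (Q ×ᴼ P)
  ×ᴼ-comm-≤T {P} {Q} = convergent⇒≤T (P ×ᴼ Q) (Q ×ᴼ P) swap
    λ (p , q) → (q , p) , λ (q≤ , p≤) → p≤ , q≤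
    where
    swap : Carrier Q × Carrier P → Carrier P × Carrier Q
    swap (q , p) = p , q

  ×ᴼ-comm-≡T : {P Q : Ord ℓ} → (P ×ᴼ Q) ≡T (Q ×ᴼ P)
  ×ᴼ-comm-≡T = ×ᴼ-comm-≤T , ×ᴼ-comm-≤T

⊇-Ord-reindex-≤T : {Z W : Set} (𝒰 : Family Z) (𝒲 : Family W) (φ : Z → W) (ψ : W → Z) →
  (∀ z → ψ (φ z) ≡ z) → (∀ {B} → 𝒲 B → 𝒰 (B ∘ φ)) → (∀ {A} → 𝒰 A → 𝒲 (A ∘ ψ)) →
  ⊇-Ord 𝒰 ≤T ⊇-Ord 𝒲
⊇-Ord-reindex-≤T 𝒰 𝒲 φ ψ ψφ≡id pull push =
  convergent⇒≤T (⊇-Ord 𝒰) (⊇-Ord 𝒲) (λ (B , B∈𝒲) → B ∘ φ , pull B∈𝒲)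
    λ (A , A∈𝒰) → (A ∘ ψ , push A∈𝒰) , λ (lift B⊆Aψ) → lift λ z → subst A (ψφ≡id z) ∘ B⊆Aψ (φ z)

·-assoc-≡T : {X Y Z : Set} (𝒰 : Family X) (𝒱 : Family Y) (𝒲 : Family Z) →
  ⊇-Ord (𝒰 · (𝒱 · 𝒲)) ≡T ⊇-Ord (𝒰 · 𝒱 · 𝒲)
·-assoc-≡T 𝒰 𝒱 𝒲 =
  ⊇-Ord-reindex-≤T (𝒰 · (𝒱 · 𝒲)) (𝒰 · 𝒱 · 𝒲) ρ ρ⁻¹ (λ _ → refl) (λ m → m) (λ m → m) ,
  ⊇-Ord-reindex-≤T (𝒰 · 𝒱 · 𝒲) (𝒰 · (𝒱 · 𝒲)) ρ⁻¹ ρ (λ _ → refl) (λ m → m) (λ m → m)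
  where
  ρ : ∀ {A B C : Set} → A × (B × C) → (A × B) × C
  ρ (a , b , c) = (a , b) , c
  ρ⁻¹ : ∀ {A B C : Set} → (A × B) × C → A × (B × C)
  ρ⁻¹ ((a , b) , c) = a , b , c

module _ {X : Set} (U : Ultrafilter X) where

  ¬mem⇒mem∁ : ∀ {A} → ¬ mem U A → mem U (∁ A)
  ¬mem⇒mem∁ {A} A∉U with ultra U A
  ... | inj₁ A∈U = ⊥-elim (A∉U A∈U)
  ... | inj₂ ∁A∈U = ∁A∈U

  module _ (em : ExcludedMiddle lzero) where

    mem-nonempty : ∀ {A} → mem U A → ∃ A
    mem-nonempty {A} A∈U with em {∃ A}
    ... | yes ∃A = ∃A
    ... | no ∄A = ⊥-elim (proper U (upward U A∈U λ x Ax → ∄A (x , Ax)))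

    mem-principal : ∀ {x₀ A} → mem U (_≡ x₀) → mem U A → A x₀
    mem-principal {A = A} x₀∈U A∈U with mem-nonempty (meet U A∈U x₀∈U)
    ... | x , Ax , refl = Ax

_⊗_ : {X Y : Set} → Ultrafilter X → Ultrafilter Y → Ultrafilter (X × Y)
U ⊗ V = record
  { mem    = mem U · mem V
  ; whole  = upward U (whole U) λ _ _ → whole V
  ; proper = λ ∅∈U⊗V → proper U (upward U ∅∈U⊗V λ _ → proper V)
  ; upward = λ A∈ A⊆B → upward U A∈ λ x Ax∈ → upward V Ax∈ λ y → A⊆B (x , y)
  ; meet   = λ A∈ B∈ → upward U (meet U A∈ B∈) λ _ (Ax∈ , Bx∈) → meet V Ax∈ Bx∈
  ; ultra  = fubini-ultra
  }
  where
  fubini-ultra : ∀ A → (mem U · mem V) A ⊎ (mem U · mem V) (∁ A)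
  fubini-ultra A with ultra U (λ x → mem V (λ y → A (x , y)))
  ... | inj₁ A∈ = inj₁ A∈
  ... | inj₂ A∉ = inj₂ (upward U A∉ λ _ → ¬mem⇒mem∁ V)

module _ (em : ExcludedMiddle lzero) {X Z : Set} (U : Ultrafilter X) (W : Ultrafilter Z) where

  ×ᴼ-≤T-· : (⊇-Ord (mem U) ×ᴼ ⊇-Ord (mem W)) ≤T ⊇-Ord (mem U · mem W)
  ×ᴼ-≤T-· = convergent⇒≤T (⊇-Ord (mem U) ×ᴼ ⊇-Ord (mem W)) (⊇-Ord (mem U · mem W)) projections
    λ ((A , A∈U) , (B , B∈W)) →
      (rectangle A B , upward U A∈U λ x Ax → upward W B∈W λ z Bz → Ax , Bz) ,
      λ (lift C⊆A×B) →
        lift (λ x Cx∈W → proj₁ (proj₂ (mem-nonempty W em (upward W Cx∈W λ z → C⊆A×B (x , z))))) ,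
        lift (λ z (x , Cxz) → proj₂ (C⊆A×B (x , z) Cxz))
    where
    rectangle : Subset X → Subset Z → Subset (X × Z)
    rectangle A B (x , z) = A x × B z
    projections : Carrier (⊇-Ord (mem U · mem W)) → Carrier (⊇-Ord (mem U) ×ᴼ ⊇-Ord (mem W))
    projections (C , C∈U·W) =
      ((λ x → mem W (λ z → C (x , z))) , C∈U·W) ,
      ((λ z → ∃ λ x → C (x , z)) ,
       let x , Cx∈W = mem-nonempty U em C∈U·W in upward W Cx∈W λ z Cxz → x , Cxz)

-- Stands in for "r has finite fibres"; unlike countability, it passes to the rank
-- r x₁ + r x₂ on products.
BoundedMeets : {X Y : Set} → Ultrafilter Y → (X → ℕ) → Set₁
BoundedMeets {X} {Y} V r = (R : Subset X) (P : X → Subset Y) → (∀ x → R x → mem V (P x)) →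
  ∀ k → mem V (λ y → ∀ x → r x < k → R x → P x y)

injective⇒BoundedMeets : ExcludedMiddle lzero → {X Y : Set} (V : Ultrafilter Y) (r : X → ℕ) →
  Injective _≡_ _≡_ r → BoundedMeets V r
injective⇒BoundedMeets em V r r-inj R P P∈V zero = upward V (whole V) λ _ _ _ ()
injective⇒BoundedMeets em {X} V r r-inj R P P∈V (suc k) =
  upward V (meet V (injective⇒BoundedMeets em V r r-inj R P P∈V k) fibre-meet)
    λ y (below-k , at-k) x rx<1+k Rx →
    [ (λ rx<k → below-k x rx<k Rx) , (λ rx≡k → at-k x rx≡k Rx) ] (m<1+n⇒m<n∨m≡n rx<1+k)
  where
  fibre-meet : mem V (λ y → ∀ x → r x ≡ k → R x → P x y)
  fibre-meet with em {∃ λ x → r x ≡ k × R x}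
  ... | yes (x₀ , rx₀≡k , Rx₀) =
          upward V (P∈V x₀ Rx₀) λ y P₀y x rx≡k _ →
            subst (λ x → P x y) (r-inj (trans rx₀≡k (sym rx≡k))) P₀y
  ... | no none = upward V (whole V) λ _ _ x rx≡k Rx → ⊥-elim (none (x , rx≡k , Rx))

BoundedMeets-+ : {X₁ X₂ Y : Set} (V : Ultrafilter Y) (r₁ : X₁ → ℕ) (r₂ : X₂ → ℕ) →
  BoundedMeets V r₁ → BoundedMeets V r₂ → BoundedMeets V (λ (x₁ , x₂) → r₁ x₁ + r₂ x₂)
BoundedMeets-+ {X₁} {X₂} {Y} V r₁ r₂ meets₁ meets₂ R P P∈V k =
  upward V (meets₁ (λ _ → ⊤) inner (λ x₁ _ → inner∈V x₁) k)
    λ y below (x₁ , x₂) r<k → below x₁ (≤-<-trans (m≤m+n (r₁ x₁) (r₂ x₂)) r<k) tt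
                                       x₂ (≤-<-trans (m≤n+m (r₂ x₂) (r₁ x₁)) r<k)
  where
  inner : X₁ → Subset Y
  inner x₁ y = ∀ x₂ → r₂ x₂ < k → R (x₁ , x₂) → P (x₁ , x₂) y
  inner∈V : ∀ x₁ → mem V (inner x₁)
  inner∈V x₁ = meets₂ (λ x₂ → R (x₁ , x₂)) (λ x₂ → P (x₁ , x₂)) (λ x₂ → P∈V (x₁ , x₂)) k

principal⊎unbounded : ExcludedMiddle lzero → {Y : Set} (V : Ultrafilter Y) (e : Y → ℕ) →
  BoundedMeets V e →
  (∃ λ y₀ → mem V (_≡ y₀)) ⊎ (∀ k → mem V (λ y → k ≤ₙ e y))
principal⊎unbounded em V e e-meets with em {∃ λ y₀ → mem V (_≡ y₀)}
... | yes principal = inj₁ principal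
... | no non-principal = inj₂ λ k →
  upward V (e-meets Whole (λ y → ∁ (_≡ y)) (λ y _ → ¬mem⇒mem∁ V λ y∈V → non-principal (y , y∈V)) k)
    λ z avoids → ≮⇒≥ λ ez<k → avoids z ez<k tt refl

module _ (em : ExcludedMiddle lzero) {X Y : Set} (U : Ultrafilter X) (V : Ultrafilter Y) where

  principal-≤T : ∀ {y₀} → mem V (_≡ y₀) →
    ⊇-Ord (mem U · mem V · mem V) ≤T (⊇-Ord (mem U) ×ᴼ ⊇-Ord (mem V · mem V))
  principal-≤T {y₀} y₀∈V = convergent⇒≤T _ _ cylinder λ (D , D∈) →
    ((slice D , upward U D∈ λ _ → at-y₀ ∘ at-y₀) , (Whole , whole (V ⊗ V))) ,
    λ (lift A⊆slice , _) → lift λ { ((x , .y₀) , .y₀) (Ax , refl , refl) → A⊆slice x Ax }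
    where
    at-y₀ : ∀ {A} → mem V A → A y₀
    at-y₀ = mem-principal V em y₀∈V
    slice : Subset ((X × Y) × Y) → Subset X
    slice D x = D ((x , y₀) , y₀)
    cylinder : Carrier (⊇-Ord (mem U) ×ᴼ ⊇-Ord (mem V · mem V)) →
               Carrier (⊇-Ord (mem U · mem V · mem V))
    cylinder ((A , A∈U) , _) =
      (λ ((x , y) , z) → A x × y ≡ y₀ × z ≡ y₀) ,
      upward U A∈U λ x Ax → upward V y₀∈V λ y y≡y₀ → upward V y₀∈V λ z z≡y₀ → Ax , y≡y₀ , z≡y₀

  module _ (r : X → ℕ) (r-meets : BoundedMeets V r)
           (e : Y → ℕ) (unbounded : ∀ k → mem V (λ y → k ≤ₙ e y)) where

    staircase : Subset X → Subset (Y × Y) → Subset ((X × Y) × Y)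
    staircase A B ((x , y) , z) = A x × (∃ λ y′ → r x ≤ₙ e y′ × e y′ ≤ₙ e y × B (y′ , y)) × B (y , z)

    staircase-mem : ∀ {A B} → mem U A → (mem V · mem V) B → (mem U · mem V · mem V) (staircase A B)
    staircase-mem {A} {B} A∈U B∈V·V = upward U A∈U λ x Ax →
      let y′ , By′∈V , rx≤ey′ = mem-nonempty V em (meet V B∈V·V (unbounded (r x)))
      in upward V (meet V (meet V By′∈V (unbounded (e y′))) B∈V·V) λ y ((By′y , ey′≤ey) , By∈V) →
           upward V By∈V λ z Byz → Ax , (y′ , rx≤ey′ , ey′≤ey , By′y) , Byz

    staircase-mono : ∀ {A A′ B B′} → A ⊆ A′ → B ⊆ B′ → staircase A B ⊆ staircase A′ B′
    staircase-mono A⊆A′ B⊆B′ ((x , y) , z) (Ax , (y′ , rx≤ey′ , ey′≤ey , By′y) , Byz) =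
      A⊆A′ x Ax , (y′ , rx≤ey′ , ey′≤ey , B⊆B′ _ By′y) , B⊆B′ _ Byz

    nonprincipal-≤T : ⊇-Ord (mem U · mem V · mem V) ≤T (⊇-Ord (mem U) ×ᴼ ⊇-Ord (mem V · mem V))
    nonprincipal-≤T =
      convergent⇒≤T _ _ (λ ((A , A∈U) , (B , B∈V·V)) → staircase A B , staircase-mem A∈U B∈V·V)
      λ (D , D∈) → ((A₀ D , D∈) , (B₀ D , B₀-mem D)) ,
        λ (lift A⊆A₀ , lift B⊆B₀) → lift λ t → staircase⊆D D t ∘ staircase-mono A⊆A₀ B⊆B₀ t
      where
      Dₓ : Subset ((X × Y) × Y) → X → Subset Y
      Dₓ D x y = mem V (λ z → D ((x , y) , z))
      A₀ : Subset ((X × Y) × Y) → Subset X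
      A₀ D x = mem V (Dₓ D x)
      -- (u , v) ∈ B₀ D constrains v only through the finitely many x with r x ≤ e u.
      B₀ : Subset ((X × Y) × Y) → Subset (Y × Y)
      B₀ D (u , v) = (∀ x → r x < suc (e u) → A₀ D x → Dₓ D x v)
                   × (∀ x → r x < suc (e u) → A₀ D x × Dₓ D x u → D ((x , u) , v))
      B₀-mem : ∀ D → (mem V · mem V) (B₀ D)
      B₀-mem D = upward V (whole V) λ u _ →
        meet V (r-meets (A₀ D) (Dₓ D) (λ _ A₀x → A₀x) (suc (e u)))
               (r-meets (λ x → A₀ D x × Dₓ D x u) (λ x v → D ((x , u) , v)) (λ _ → proj₂) (suc (e u)))
      staircase⊆D : ∀ D → staircase (A₀ D) (B₀ D) ⊆ D
      staircase⊆D D ((x , y) , z) (A₀x , (y′ , rx≤ey′ , ey′≤ey , (slices , _)) , (_ , fibres)) =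
        fibres x (s≤s (≤-trans rx≤ey′ ey′≤ey)) (A₀x , slices x (s≤s rx≤ey′) A₀x)

·-square-≡T-×ᴼ : ExcludedMiddle lzero → {X Y : Set} (U : Ultrafilter X) (V : Ultrafilter Y) →
  (r : X → ℕ) → BoundedMeets V r → (e : Y → ℕ) → BoundedMeets V e →
  ⊇-Ord (mem U · mem V · mem V) ≡T (⊇-Ord (mem U) ×ᴼ ⊇-Ord (mem V · mem V))
·-square-≡T-×ᴼ em U V r r-meets e e-meets = reduce (principal⊎unbounded em V e e-meets) ,
  ≤T-trans (×ᴼ-≤T-· em U (V ⊗ V)) (proj₁ (·-assoc-≡T (mem U) (mem V) (mem V)))
  where
  reduce : (∃ λ y₀ → mem V (_≡ y₀)) ⊎ (∀ k → mem V (λ y → k ≤ₙ e y)) →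
           ⊇-Ord (mem U · mem V · mem V) ≤T (⊇-Ord (mem U) ×ᴼ ⊇-Ord (mem V · mem V))
  reduce (inj₁ (_ , y₀∈V)) = principal-≤T em U V y₀∈V
  reduce (inj₂ unbounded) = nonprincipal-≤T em U V r r-meets e unbounded

corollary1p10 : (∀ {ℓ} → ExcludedMiddle ℓ) →
    {X Y : Set} → Countable X → Countable Y →
    (U : Ultrafilter X) (V : Ultrafilter Y) →
    (⊇-Ord (mem U · mem V · mem V) ≡T (⊇-Ord (mem U) ×ᴼ ⊇-Ord (mem V · mem V)))
    × (⊇-Ord ((mem U · mem U) · (mem V · mem V)) ≡T ⊇-Ord ((mem V · mem V) · (mem U · mem U)))
corollary1p10 em {X} {Y} (r , r-inj) (e , e-inj) U V =
  ·-square-≡T-×ᴼ em U V r r-meets-V e e-meets-V ,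
  ≡T-trans (·-assoc-≡T (mem U · mem U) (mem V) (mem V))
  (≡T-trans (·-square-≡T-×ᴼ em (U ⊗ U) V r² (BoundedMeets-+ V r r r-meets-V r-meets-V) e e-meets-V)
  (≡T-trans ×ᴼ-comm-≡T
  (≡T-trans (≡T-sym (·-square-≡T-×ᴼ em (V ⊗ V) U e² (BoundedMeets-+ U e e e-meets-U e-meets-U) r r-meets-U))
  (≡T-sym (·-assoc-≡T (mem V · mem V) (mem U) (mem U))))))
  where
  r-meets-V : BoundedMeets V r
  r-meets-V = injective⇒BoundedMeets em V r r-inj
  r-meets-U : BoundedMeets U r
  r-meets-U = injective⇒BoundedMeets em U r r-inj
  e-meets-V : BoundedMeets V e
  e-meets-V = injective⇒BoundedMeets em V e e-inj
  e-meets-U : BoundedMeets U e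
  e-meets-U = injective⇒BoundedMeets em U e e-inj
  r² : X × X → ℕ
  r² (x₁ , x₂) = r x₁ + r x₂
  e² : Y × Y → ℕ
  e² (y₁ , y₂) = e y₁ + e y₂
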